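{- Let $T$ be an $(r \times c, v)$-near triple array (with $r,c,v\ge 2$) with average replication number $e=rc/v$ and average column intersection size $\lambda_{cc}$. Let $\mu_c := \binom{r}{2}c / \binom{v}{2} = \frac{e(r-1)}{v-1}$ (the average number of columns containing a given pair of distinct symbols), and $\mu_c^- = \lfloor \mu_c\rfloor$, $\mu_c^+=\lceil \mu_c\rceil$. Then \[ S\Big(\binom{c}{2}, \lambda_{cc}\Big) \geq S\Big(\binom{v}{2}, \mu_c\Big), \] and equality holds if and only if every pair of distinct symbols is contained together in exactly $\mu_c^-$ or exactly $\mu_c^+$ columns of $T$.
   Context: For an integer $n$ and a real $m$, with $m^-=\lfloor m\rfloor$, $m^+=\lceil m\rceil$ and $\binom{m}{2}:=m(m-1)/2$, define $S(n,m) := n\binom{m}{2} + \frac{n(m-m^-)(m^+-m)}{2}$. An $r\times c$ row-column design on $v$ symbols is an $r\times c$ array each of whose cells is filled with one of $v$ symbols. It is binary if no symbol occurs more than once in any row or in any column. Let $e=rc/v$, $e^-=\lfloor e\rfloor$, $e^+=\lceil e\rceil$. The design is equireplicate if $e$ is an integer and every symbol occurs exactly $e$ times, and near equireplicate if $e$ is not an integer and every symbol occurs $e^-$ or $e^+$ times. For a binary design, let $R_i$, $C_j$ be the symbol sets of row $i$ and column $j$, and put $\lambda_{rc}=\frac{1}{rc}\sum_{i,j}|R_i\cap C_j|$, $\lambda_{rr}=\binom{r}{2}^{ -1}\sum_{i<j}|R_i\cap R_j|$, $\lambda_{cc}=\binom{c}{2}^{ -1}\sum_{i<j}|C_i\cap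 C_j|$; for real $x$, $x^-=\lfloor x\rfloor$, $x^+=\lceil x\rceil$. An $(r\times c,v)$-near triple array is a binary $r\times c$ row-column design on $v$ symbols which is equireplicate or near equireplicate and in which every row and column share $\lambda_{rc}^-$ or $\lambda_{rc}^+$ symbols, every two distinct rows share $\lambda_{rr}^-$ or $\lambda_{rr}^+$ symbols, and every two distinct columns share $\lambda_{cc}^-$ or $\lambda_{cc}^+$ symbols. -}

module Defs where

open import Data.Nat as ℕ using (ℕ; zero; suc; _<ᵇ_)
open import Data.Nat.Combinatorics using (_C_)
open import Data.Integer as ℤ using (ℤ; +_)
open import Data.Rational as ℚ using (ℚ; floor; ceiling; 0ℚ)
open import Data.Fin using (Fin; toℕ)
open import Data.Fin.Properties using () renaming (_≟_ to _≟ᶠ_)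
open import Data.List using (List; map; allFin; foldr)
open import Data.Nat.ListAction using (sum)
open import Data.Bool using (Bool; true; false; if_then_else_; _∧_)
open import Data.Product using (_×_)
open import Data.Sum using (_⊎_)
open import Relation.Nullary.Decidable using (does)
open import Relation.Binary.PropositionalEquality using (_≡_; _≢_)

Σ[_] : (n : ℕ) → (Fin n → ℕ) → ℕ
Σ[ n ] f = sum (map f (allFin n))

Σpairs : (n : ℕ) → (Fin n → Fin n → ℕ) → ℕ
Σpairs n f = Σ[ n ] (λ i → Σ[ n ] (λ j → if toℕ i <ᵇ toℕ j then f i j else 0))

count : (n : ℕ) → (Fin n → Bool) → ℕ
count n p = Σ[ n ] (λ i → if p i then 1 else 0)

anyF : (n : ℕ) → (Fin n → Bool) → Bool
anyF n p = foldr (λ i b → if p i then true else b) false (allFin n)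

ℕ→ℚ : ℕ → ℚ
ℕ→ℚ n = (+ n) ℚ./ 1

ℤ→ℚ : ℤ → ℚ
ℤ→ℚ z = z ℚ./ 1

-- a / b as a rational (convention: 0 if b = 0; only used with b ≠ 0)
frac : ℕ → ℕ → ℚ
frac a zero    = 0ℚ
frac a (suc b) = (+ a) ℚ./ suc b

binom2 : ℚ → ℚ
binom2 m = (m ℚ.* (m ℚ.- ℚ.1ℚ)) ℚ.* ℚ.½

S : ℕ → ℚ → ℚ
S n m = ℕ→ℚ n ℚ.* binom2 m
      ℚ.+ ((ℕ→ℚ n ℚ.* (m ℚ.- ℤ→ℚ (floor m))) ℚ.* (ℤ→ℚ (ceiling m) ℚ.- m)) ℚ.* ℚ.½

FloorOrCeil : ℕ → ℚ → Set
FloorOrCeil k x = (+ k ≡ floor x) ⊎ (+ k ≡ ceiling x)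

Design : ℕ → ℕ → ℕ → Set
Design r c v = Fin r → Fin c → Fin v

module _ {r c v : ℕ} (T : Design r c v) where

  Binary : Set
  Binary = (∀ i j j′ → T i j ≡ T i j′ → j ≡ j′) × (∀ i i′ j → T i j ≡ T i′ j → i ≡ i′)

  inRow : Fin r → Fin v → Bool
  inRow i s = anyF c (λ j → does (T i j ≟ᶠ s))

  inCol : Fin c → Fin v → Bool
  inCol j s = anyF r (λ i → does (T i j ≟ᶠ s))

  rowColInt : Fin r → Fin c → ℕ
  rowColInt i j = count v (λ s → inRow i s ∧ inCol j s)

  rowRowInt : Fin r → Fin r → ℕ
  rowRowInt i i′ = count v (λ s → inRow i s ∧ inRow i′ s)

  colColInt : Fin c → Fin c → ℕ
  colColInt j j′ = count v (λ s → inCol j s ∧ inCol j′ s)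

  replication : Fin v → ℕ
  replication s = Σ[ r ] (λ i → count c (λ j → does (T i j ≟ᶠ s)))

  pairColCount : Fin v → Fin v → ℕ
  pairColCount s t = count c (λ j → inCol j s ∧ inCol j t)

  eAvg : ℚ
  eAvg = frac (r ℕ.* c) v

  λrc : ℚ
  λrc = frac (Σ[ r ] (λ i → Σ[ c ] (λ j → rowColInt i j))) (r ℕ.* c)

  λrr : ℚ
  λrr = frac (Σpairs r rowRowInt) (r C 2)

  λcc : ℚ
  λcc = frac (Σpairs c colColInt) (c C 2)

  -- equireplicate (e integer: every symbol e times) or near equireplicate
  -- (e non-integer: every symbol ⌊e⌋ or ⌈e⌉ times); both cases are captured
  -- uniformly since ⌊e⌋ = ⌈e⌉ = e when e is an integer
  EquiOrNearEqui : Set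
  EquiOrNearEqui = ∀ s → FloorOrCeil (replication s) eAvg

  IsNearTripleArray : Set
  IsNearTripleArray =
    Binary × EquiOrNearEqui
    × (∀ i j → FloorOrCeil (rowColInt i j) λrc)
    × (∀ i i′ → i ≢ i′ → FloorOrCeil (rowRowInt i i′) λrr)
    × (∀ j j′ → j ≢ j′ → FloorOrCeil (colColInt j j′) λcc)

μc : ℕ → ℕ → ℕ → ℚ
μc r c v = frac ((r C 2) ℕ.* c) (v C 2)

{-# OPTIONS --safe #-}

-- Let λ_{jj′} = |C_j ∩ C_j′| and let μ_{st} be the number of columns containing both symbols s and t.
-- Counting the 2 × 2 all-one submatrices of the column–symbol incidence matrix in two ways gives
--   Σ_{j<j′} λ_{jj′}² + Σ_{s<t} μ_{st} = Σ_{s<t} μ_{st}² + Σ_{j<j′} λ_{jj′},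
-- and Σ_{s<t} μ_{st} = c·C(r,2) because every column of a binary array holds r distinct symbols.
-- For N naturals x_i with sum L and a = ⌊L / N⌋,
--   Σ x_i² = L + 2 S(N, L / N) + Σ (x_i − a)(x_i − a − 1),
-- where every (x − a)(x − a − 1) is a natural number vanishing exactly at x ∈ {a, a + 1}.
-- For the columns of a near triple array this defect vanishes, so eliminating the sums of squares yields
--   S(C(c,2), λ_cc) = S(C(v,2), μ_c) + ½ Σ_{s<t} (μ_{st} − a)(μ_{st} − a − 1),  a = ⌊μ_c⌋.
-- So equality holds iff every μ_{st} lies in {a, a + 1}; when μ_c is an integer, the value a + 1 is
-- excluded because the μ_{st} sum to a·C(v,2).

module Submission where

open import Defs
open import Data.Nat as ℕ using (ℕ; zero; suc; s≤s; _+_; _*_; _∸_; _/_; _%_; _<ᵇ_; _≤_; _<_; NonZero)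
open import Data.Nat.DivMod using (m≡m%n+[m/n]*n; m/n*n≡m; m*n/o*n≡m/o; m%n*o≡m*o%[n*o]; /-congˡ; /-congʳ; %-congˡ; %-congʳ)
open import Data.Nat.GCD using (gcd; gcd[m,n]∣m; gcd[m,n]∣n; gcd[m,n]≢0; n/gcd[m,n]≢0)
open import Data.Nat.Coprimality using (Coprime)
open import Data.Nat.Properties
  using (+-*-semiring; *-comm; *-zeroʳ; *-identityʳ; +-identityʳ; m+n≡0⇒m≡0; m+n≡0⇒n≡0
        ; <-cmp; <ᵇ⇒<; _<?_; +-cancelˡ-≡; +-cancelʳ-≡; *-cancelˡ-≡; m+[n∸m]≡n; m∸n≡0⇒m≤n
        ; ≤-antisym; ≤-reflexive; n≤1+n; 1+n≢n; m*n≢0; m*n≡0⇒m≡0)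
import Data.Nat.ListAction as List
open import Data.Nat.Combinatorics using (_C_; nC1≡n; nCk+nC[k+1]≡[n+1]C[k+1])
open import Data.Nat.Tactic.RingSolver using (solve-∀)
open import Algebra.Properties.Semiring.Sum +-*-semiring
  using (sum-syntax; sum-cong-≗; sum-replicate-zero; ∑-distrib-+; ∑-comm; *-distribˡ-sum; *-distribʳ-sum)
import Data.Integer as ℤ
import Data.Integer.Properties as ℤₚ
open import Data.Rational as ℚ using (ℚ; floor; ceiling; mkℚ+; _≥_)
import Data.Rational.Properties as ℚₚ
open import Data.Rational.Solver using (module +-*-Solver)
open import Algebra.Properties.Group ℚₚ.+-0-group using (∙-cancelʳ; identityʳ-unique)
open import Data.Rational.Unnormalised as ℚᵘ using (ℚᵘ; mkℚᵘ; *≡*)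
import Data.Rational.Unnormalised.Properties as ℚᵘₚ
open import Data.Fin using (Fin; zero; suc; toℕ)
open import Data.Fin.Properties using (toℕ-injective; suc-injective; _≟_; <⇒≢) renaming (<-cmp to <-cmpᶠ)
open import Data.List using (tabulate; allFin; foldr)
open import Data.List.Properties using (map-tabulate; foldr-map)
open import Data.Bool using (Bool; true; false; if_then_else_; _∧_)
open import Function using (id; _∘_; flip)
open import Data.Sum as Sum using (_⊎_; inj₁; inj₂)
open import Relation.Nullary using (¬_; Dec; does; yes; no; contradiction)
open import Relation.Nullary.Decidable using (dec-true; dec-false)
open import Data.Product using (_×_; _,_)
open import Function.Bundles using (_⇔_; mk⇔)
open import Relation.Binary.Definitions using (tri<; tri≈; tri>)
open import Relation.Binary.PropositionalEquality
open ≡-Reasoning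

Σ≡∑ : ∀ n (f : Fin n → ℕ) → Σ[ n ] f ≡ ∑[ i < n ] f i
Σ≡∑ n f = trans (cong List.sum (map-tabulate id f)) (sum-tabulate n f)
  where
  sum-tabulate : ∀ n (f : Fin n → ℕ) → List.sum (tabulate f) ≡ ∑[ i < n ] f i
  sum-tabulate zero    f = refl
  sum-tabulate (suc n) f = cong (f zero +_) (sum-tabulate n (f ∘ suc))

∑-const : ∀ n k → ∑[ i < n ] k ≡ n * k
∑-const zero    k = refl
∑-const (suc n) k = cong (k +_) (∑-const n k)

∑≡0⇒ : ∀ {n} (f : Fin n → ℕ) → ∑[ i < n ] f i ≡ 0 → ∀ i → f i ≡ 0
∑≡0⇒ f ∑f≡0 zero    = m+n≡0⇒m≡0 (f zero) ∑f≡0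
∑≡0⇒ f ∑f≡0 (suc i) = ∑≡0⇒ (f ∘ suc) (m+n≡0⇒n≡0 (f zero) ∑f≡0) i

∑-δ : ∀ {n} (i : Fin n) (g : Fin n → ℕ) → ∑[ j < n ] (if does (i ≟ j) then g j else 0) ≡ g i
∑-δ {suc n} zero    g = trans (cong (g zero +_) (sum-replicate-zero n)) (+-identityʳ (g zero))
∑-δ {suc n} (suc i) g = ∑-δ i (g ∘ suc)

∑∑-distrib-+ : ∀ m n (f g : Fin m → Fin n → ℕ) →
  ∑[ i < m ] ∑[ j < n ] (f i j + g i j) ≡ ∑[ i < m ] ∑[ j < n ] f i j + ∑[ i < m ] ∑[ j < n ] g i j
∑∑-distrib-+ m n f g = trans (sum-cong-≗ {m} (λ i → ∑-distrib-+ {n} (f i) (g i))) (∑-distrib-+ {m} _ _)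

∑-*-∑ : ∀ m n (f : Fin m → ℕ) (g : Fin n → ℕ) →
  ∑[ i < m ] f i * ∑[ j < n ] g j ≡ ∑[ i < m ] ∑[ j < n ] (f i * g j)
∑-*-∑ m n f g = trans (*-distribʳ-sum {m} (∑[ j < n ] g j) f) (sum-cong-≗ {m} (λ i → *-distribˡ-sum {n} (f i) g))

<ᵇ-true : ∀ {m n} → m < n → (m <ᵇ n) ≡ true
<ᵇ-true {m} {n} = dec-true (m <? n)

<ᵇ-false : ∀ {m n} → ¬ m < n → (m <ᵇ n) ≡ false
<ᵇ-false {m} {n} = dec-false (m <? n)

upper : ∀ {n} → (Fin n → Fin n → ℕ) → Fin n → Fin n → ℕ
upper f i j = if toℕ i <ᵇ toℕ j then f i j else 0

Σpairs≡∑ : ∀ n (f : Fin n → Fin n → ℕ) → Σpairs n f ≡ ∑[ i < n ] ∑[ j < n ] upper f i j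
Σpairs≡∑ n f = trans (Σ≡∑ n _) (sum-cong-≗ {n} (λ i → Σ≡∑ n _))

Σpairs-cong : ∀ n {f g : Fin n → Fin n → ℕ} →
  (∀ i j → toℕ i < toℕ j → f i j ≡ g i j) → Σpairs n f ≡ Σpairs n g
Σpairs-cong n {f} {g} f≡g = begin
  Σpairs n f                          ≡⟨ Σpairs≡∑ n f ⟩
  ∑[ i < n ] ∑[ j < n ] upper f i j   ≡⟨ sum-cong-≗ {n} (λ i → sum-cong-≗ {n} (upper-cong i)) ⟩
  ∑[ i < n ] ∑[ j < n ] upper g i j   ≡⟨ sym (Σpairs≡∑ n g) ⟩
  Σpairs n g                          ∎
  where
  upper-cong : ∀ i j → upper f i j ≡ upper g i j
  upper-cong i j with toℕ i <ᵇ toℕ j | <ᵇ⇒< (toℕ i) (toℕ j)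
  ... | true  | i<j = f≡g i j (i<j _)
  ... | false | _   = refl

Σpairs-+ : ∀ n (f g : Fin n → Fin n → ℕ) → Σpairs n (λ i j → f i j + g i j) ≡ Σpairs n f + Σpairs n g
Σpairs-+ n f g = begin
  Σpairs n (λ i j → f i j + g i j)
    ≡⟨ Σpairs≡∑ n _ ⟩
  ∑[ i < n ] ∑[ j < n ] upper (λ i j → f i j + g i j) i j
    ≡⟨ sum-cong-≗ {n} (λ i → sum-cong-≗ {n} (λ j → if-+ (toℕ i <ᵇ toℕ j))) ⟩
  ∑[ i < n ] ∑[ j < n ] (upper f i j + upper g i j)
    ≡⟨ ∑∑-distrib-+ n n (upper f) (upper g) ⟩
  ∑[ i < n ] ∑[ j < n ] upper f i j + ∑[ i < n ] ∑[ j < n ] upper g i j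
    ≡⟨ sym (cong₂ _+_ (Σpairs≡∑ n f) (Σpairs≡∑ n g)) ⟩
  Σpairs n f + Σpairs n g ∎
  where
  if-+ : ∀ b {x y : ℕ} → (if b then x + y else 0) ≡ (if b then x else 0) + (if b then y else 0)
  if-+ true  = refl
  if-+ false = refl

Σpairs-*ˡ : ∀ n k (f : Fin n → Fin n → ℕ) → k * Σpairs n f ≡ Σpairs n (λ i j → k * f i j)
Σpairs-*ˡ n k f = begin
  k * Σpairs n f
    ≡⟨ cong (k *_) (Σpairs≡∑ n f) ⟩
  k * ∑[ i < n ] ∑[ j < n ] upper f i j
    ≡⟨ *-distribˡ-sum {n} k _ ⟩
  ∑[ i < n ] (k * ∑[ j < n ] upper f i j)
    ≡⟨ sum-cong-≗ {n} (λ i → trans (*-distribˡ-sum {n} k _) (sum-cong-≗ {n} (λ j → *-if (toℕ i <ᵇ toℕ j)))) ⟩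
  ∑[ i < n ] ∑[ j < n ] upper (λ i j → k * f i j) i j
    ≡⟨ sym (Σpairs≡∑ n _) ⟩
  Σpairs n (λ i j → k * f i j) ∎
  where
  *-if : ∀ b {x : ℕ} → k * (if b then x else 0) ≡ (if b then k * x else 0)
  *-if true  = refl
  *-if false = *-zeroʳ k

Σpairs≡0⇒ : ∀ n (f : Fin n → Fin n → ℕ) → Σpairs n f ≡ 0 → ∀ i j → toℕ i < toℕ j → f i j ≡ 0
Σpairs≡0⇒ n f Σf≡0 i j i<j =
  subst (λ b → (if b then f i j else 0) ≡ 0) (<ᵇ-true i<j)
        (∑≡0⇒ _ (∑≡0⇒ _ (trans (sym (Σpairs≡∑ n f)) Σf≡0) i) j)

split-at-diagonal : ∀ {n} (i j : Fin n) (x : ℕ) →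
  x ≡ (if toℕ i <ᵇ toℕ j then x else 0) + (if toℕ j <ᵇ toℕ i then x else 0) + (if does (i ≟ j) then x else 0)
split-at-diagonal i j x with <-cmp (toℕ i) (toℕ j)
... | tri< i<j i≢j j≮i
  rewrite <ᵇ-true i<j | <ᵇ-false j≮i | dec-false (i ≟ j) (i≢j ∘ cong toℕ) =
  sym (trans (+-identityʳ (x + 0)) (+-identityʳ x))
... | tri≈ i≮j i≡j j≮i
  rewrite <ᵇ-false i≮j | <ᵇ-false j≮i | dec-true (i ≟ j) (toℕ-injective i≡j) = refl
... | tri> i≮j i≢j j<i
  rewrite <ᵇ-false i≮j | <ᵇ-true j<i | dec-false (i ≟ j) (i≢j ∘ cong toℕ) = sym (+-identityʳ x)

Σpairs-symmetric : ∀ n (f : Fin n → Fin n → ℕ) → (∀ i j → f i j ≡ f j i) →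
  2 * Σpairs n f + ∑[ i < n ] f i i ≡ ∑[ i < n ] ∑[ j < n ] f i j
Σpairs-symmetric n f f-sym = sym (begin
  ∑[ i < n ] ∑[ j < n ] f i j
    ≡⟨ sum-cong-≗ {n} (λ i → sum-cong-≗ {n} (λ j → split-at-diagonal i j (f i j))) ⟩
  ∑[ i < n ] ∑[ j < n ] (upper f i j + upper (flip f) j i + diagonal i j)
    ≡⟨ trans (∑∑-distrib-+ n n _ _) (cong (_+ ∑∑diagonal) (∑∑-distrib-+ n n _ _)) ⟩
  ∑[ i < n ] ∑[ j < n ] upper f i j + ∑[ i < n ] ∑[ j < n ] upper (flip f) j i + ∑∑diagonal
    ≡⟨ cong₂ (λ a b → a + b + ∑∑diagonal)
             (sym (Σpairs≡∑ n f)) (trans (∑-comm {n} {n} _) (sym (Σpairs≡∑ n (flip f)))) ⟩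
  Σpairs n f + Σpairs n (flip f) + ∑∑diagonal
    ≡⟨ cong₂ (λ a b → Σpairs n f + a + b)
             (Σpairs-cong n (λ i j _ → sym (f-sym i j))) (sum-cong-≗ {n} (λ i → ∑-δ i (f i))) ⟩
  Σpairs n f + Σpairs n f + ∑[ i < n ] f i i
    ≡⟨ cong (λ a → Σpairs n f + a + ∑[ i < n ] f i i) (sym (+-identityʳ (Σpairs n f))) ⟩
  2 * Σpairs n f + ∑[ i < n ] f i i ∎)
  where
  diagonal : Fin n → Fin n → ℕ
  diagonal i j = if does (i ≟ j) then f i j else 0
  ∑∑diagonal : ℕ
  ∑∑diagonal = ∑[ i < n ] ∑[ j < n ] diagonal i j

2*nC2+n≡n*n : ∀ n → 2 * (n C 2) + n ≡ n * n
2*nC2+n≡n*n zero    = refl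
2*nC2+n≡n*n (suc n) = begin
  2 * (suc n C 2) + suc n          ≡⟨ cong (λ c → 2 * c + suc n) (sym (nCk+nC[k+1]≡[n+1]C[k+1] n 1)) ⟩
  2 * (n C 1 + n C 2) + suc n      ≡⟨ cong (λ c → 2 * (c + n C 2) + suc n) (nC1≡n n) ⟩
  2 * (n + n C 2) + suc n          ≡⟨ regroup n (n C 2) ⟩
  (2 * (n C 2) + n) + suc (2 * n)  ≡⟨ cong (_+ suc (2 * n)) (2*nC2+n≡n*n n) ⟩
  n * n + suc (2 * n)              ≡⟨ square-suc n ⟩
  suc n * suc n                    ∎
  where
  regroup : ∀ n c → 2 * (n + c) + suc n ≡ (2 * c + n) + suc (2 * n)
  regroup = solve-∀
  square-suc : ∀ n → n * n + suc (2 * n) ≡ suc n * suc n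
  square-suc = solve-∀

Σpairs-1 : ∀ n → Σpairs n (λ _ _ → 1) ≡ n C 2
Σpairs-1 n = *-cancelˡ-≡ _ _ 2 (+-cancelʳ-≡ n _ _ (begin
  2 * Σpairs n (λ _ _ → 1) + n               ≡⟨ cong (2 * Σpairs n (λ _ _ → 1) +_) (sym (trans (∑-const n 1) (*-identityʳ n))) ⟩
  2 * Σpairs n (λ _ _ → 1) + ∑[ i < n ] 1    ≡⟨ Σpairs-symmetric n (λ _ _ → 1) (λ _ _ → refl) ⟩
  ∑[ i < n ] ∑[ j < n ] 1                    ≡⟨ trans (sum-cong-≗ {n} (λ _ → trans (∑-const n 1) (*-identityʳ n))) (∑-const n n) ⟩
  n * n                                      ≡⟨ sym (2*nC2+n≡n*n n) ⟩
  2 * (n C 2) + n                            ∎))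

Σpairs-const : ∀ n k → Σpairs n (λ _ _ → k) ≡ k * (n C 2)
Σpairs-const n k = begin
  Σpairs n (λ _ _ → k)      ≡⟨ Σpairs-cong n (λ _ _ _ → sym (*-identityʳ k)) ⟩
  Σpairs n (λ _ _ → k * 1)  ≡⟨ sym (Σpairs-*ˡ n k (λ _ _ → 1)) ⟩
  k * Σpairs n (λ _ _ → 1)  ≡⟨ cong (k *_) (Σpairs-1 n) ⟩
  k * (n C 2)               ∎

Σpairs-zero : ∀ n (f : Fin n → Fin n → ℕ) → (∀ i j → toℕ i < toℕ j → f i j ≡ 0) → Σpairs n f ≡ 0
Σpairs-zero n f f≡0 = trans (Σpairs-cong n f≡0) (Σpairs-const n 0)

Σpairs-tight : ∀ n a (f : Fin n → Fin n → ℕ) → (∀ i j → toℕ i < toℕ j → a ≤ f i j) →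
  Σpairs n f ≡ a * (n C 2) → ∀ i j → toℕ i < toℕ j → f i j ≡ a
Σpairs-tight n a f a≤f Σf≡ i j i<j =
  ≤-antisym (m∸n≡0⇒m≤n (Σpairs≡0⇒ n excess Σexcess≡0 i j i<j)) (a≤f i j i<j)
  where
  excess : Fin n → Fin n → ℕ
  excess i j = f i j ∸ a
  Σexcess≡0 : Σpairs n excess ≡ 0
  Σexcess≡0 = +-cancelˡ-≡ (a * (n C 2)) _ _ (begin
    a * (n C 2) + Σpairs n excess                ≡⟨ cong (_+ Σpairs n excess) (sym (Σpairs-const n a)) ⟩
    Σpairs n (λ _ _ → a) + Σpairs n excess       ≡⟨ sym (Σpairs-+ n _ _) ⟩
    Σpairs n (λ i j → a + excess i j)            ≡⟨ Σpairs-cong n (λ i j i<j → m+[n∸m]≡n (a≤f i j i<j)) ⟩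
    Σpairs n f                                   ≡⟨ trans Σf≡ (sym (+-identityʳ _)) ⟩
    a * (n C 2) + 0                              ∎)

off-diagonal-by-symmetry : ∀ {n} {P : ℕ → Set} (f : Fin n → Fin n → ℕ) → (∀ i j → f i j ≡ f j i) →
  (∀ i j → toℕ i < toℕ j → P (f i j)) → ∀ i j → i ≢ j → P (f i j)
off-diagonal-by-symmetry {P = P} f f-sym P-above i j i≢j with <-cmpᶠ i j
... | tri< i<j _ _ = P-above i j i<j
... | tri≈ _ i≡j _ = contradiction i≡j i≢j
... | tri> _ _ j<i = subst P (f-sym j i) (P-above j i j<i)

-- Gram matrices of 0/1 matrices

gram : ∀ {m n} → (Fin m → Fin n → ℕ) → Fin m → Fin m → ℕ
gram {n = n} u i i′ = ∑[ k < n ] (u i k * u i′ k)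

ZeroOne : ∀ {m n} → (Fin m → Fin n → ℕ) → Set
ZeroOne u = ∀ i k → u i k * u i k ≡ u i k

gram-sym : ∀ {m n} (u : Fin m → Fin n → ℕ) i i′ → gram u i i′ ≡ gram u i′ i
gram-sym {n = n} u i i′ = sum-cong-≗ {n} (λ k → *-comm (u i k) (u i′ k))

gram-diagonal : ∀ {m n} {u : Fin m → Fin n → ℕ} → ZeroOne u → ∀ i → gram u i i ≡ ∑[ k < n ] u i k
gram-diagonal {n = n} u01 i = sum-cong-≗ {n} (u01 i)

∑∑-gram : ∀ m n (u : Fin m → Fin n → ℕ) →
  ∑[ i < m ] ∑[ i′ < m ] gram u i i′ ≡ ∑[ k < n ] (∑[ i < m ] u i k * ∑[ i < m ] u i k)
∑∑-gram m n u = begin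
  ∑[ i < m ] ∑[ i′ < m ] ∑[ k < n ] (u i k * u i′ k)  ≡⟨ sum-cong-≗ {m} (λ i → ∑-comm {m} {n} _) ⟩
  ∑[ i < m ] ∑[ k < n ] ∑[ i′ < m ] (u i k * u i′ k)  ≡⟨ ∑-comm {m} {n} _ ⟩
  ∑[ k < n ] ∑[ i < m ] ∑[ i′ < m ] (u i k * u i′ k)  ≡⟨ sum-cong-≗ {n} (λ k → sym (∑-*-∑ m m (λ i → u i k) (λ i → u i k))) ⟩
  ∑[ k < n ] (∑[ i < m ] u i k * ∑[ i < m ] u i k)    ∎

∑∑-gram-squared : ∀ m n (u : Fin m → Fin n → ℕ) →
  ∑[ i < m ] ∑[ i′ < m ] (gram u i i′ * gram u i i′)
    ≡ ∑[ k < n ] ∑[ k′ < n ] (gram (flip u) k k′ * gram (flip u) k k′)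
∑∑-gram-squared m n u = begin
  ∑[ i < m ] ∑[ i′ < m ] (gram u i i′ * gram u i i′)
    ≡⟨ sum-cong-≗ {m} (λ i → sum-cong-≗ {m} (λ i′ → expand i i′)) ⟩
  ∑[ i < m ] ∑[ i′ < m ] ∑[ k < n ] ∑[ k′ < n ] (p i k k′ * p i′ k k′)
    ≡⟨ sum-cong-≗ {m} (λ i → ∑-comm {m} {n} _) ⟩
  ∑[ i < m ] ∑[ k < n ] ∑[ i′ < m ] ∑[ k′ < n ] (p i k k′ * p i′ k k′)
    ≡⟨ ∑-comm {m} {n} _ ⟩
  ∑[ k < n ] ∑[ i < m ] ∑[ i′ < m ] ∑[ k′ < n ] (p i k k′ * p i′ k k′)
    ≡⟨ sum-cong-≗ {n} (λ k → sum-cong-≗ {m} (λ i → ∑-comm {m} {n} _)) ⟩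
  ∑[ k < n ] ∑[ i < m ] ∑[ k′ < n ] ∑[ i′ < m ] (p i k k′ * p i′ k k′)
    ≡⟨ sum-cong-≗ {n} (λ k → ∑-comm {m} {n} _) ⟩
  ∑[ k < n ] ∑[ k′ < n ] ∑[ i < m ] ∑[ i′ < m ] (p i k k′ * p i′ k k′)
    ≡⟨ sum-cong-≗ {n} (λ k → sum-cong-≗ {n} (λ k′ → sym (∑-*-∑ m m (λ i → p i k k′) (λ i′ → p i′ k k′)))) ⟩
  ∑[ k < n ] ∑[ k′ < n ] (gram (flip u) k k′ * gram (flip u) k k′) ∎
  where
  p : Fin m → Fin n → Fin n → ℕ
  p i k k′ = u i k * u i k′
  expand : ∀ i i′ → gram u i i′ * gram u i i′ ≡ ∑[ k < n ] ∑[ k′ < n ] (p i k k′ * p i′ k k′)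
  expand i i′ = trans (∑-*-∑ n n _ _) (sum-cong-≗ {n} (λ k → sum-cong-≗ {n} (λ k′ →
    interchange (u i k) (u i′ k) (u i k′) (u i′ k′))))
    where
    interchange : ∀ a b c d → (a * b) * (c * d) ≡ (a * c) * (b * d)
    interchange = solve-∀

2*Σpairs-gram : ∀ m n (u : Fin m → Fin n → ℕ) → ZeroOne u →
  2 * Σpairs m (gram u) + ∑[ i < m ] ∑[ k < n ] u i k ≡ ∑[ k < n ] (∑[ i < m ] u i k * ∑[ i < m ] u i k)
2*Σpairs-gram m n u u01 = begin
  2 * Σpairs m (gram u) + ∑[ i < m ] ∑[ k < n ] u i k
    ≡⟨ cong (2 * Σpairs m (gram u) +_) (sym (sum-cong-≗ {m} (gram-diagonal u01))) ⟩
  2 * Σpairs m (gram u) + ∑[ i < m ] gram u i i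
    ≡⟨ Σpairs-symmetric m (gram u) (gram-sym u) ⟩
  ∑[ i < m ] ∑[ i′ < m ] gram u i i′
    ≡⟨ ∑∑-gram m n u ⟩
  ∑[ k < n ] (∑[ i < m ] u i k * ∑[ i < m ] u i k) ∎

2*Σpairs-gram-squared : ∀ m n (u : Fin m → Fin n → ℕ) → ZeroOne u →
  2 * Σpairs m (λ i i′ → gram u i i′ * gram u i i′) + ∑[ i < m ] (∑[ k < n ] u i k * ∑[ k < n ] u i k)
    ≡ ∑[ i < m ] ∑[ i′ < m ] (gram u i i′ * gram u i i′)
2*Σpairs-gram-squared m n u u01 = begin
  2 * Σpairs m (λ i i′ → gram u i i′ * gram u i i′) + ∑[ i < m ] (∑[ k < n ] u i k * ∑[ k < n ] u i k)
    ≡⟨ cong (2 * Σpairs m (λ i i′ → gram u i i′ * gram u i i′) +_)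
            (sym (sum-cong-≗ {m} (λ i → cong₂ _*_ (gram-diagonal u01 i) (gram-diagonal u01 i)))) ⟩
  2 * Σpairs m (λ i i′ → gram u i i′ * gram u i i′) + ∑[ i < m ] (gram u i i * gram u i i)
    ≡⟨ Σpairs-symmetric m _ (λ i i′ → cong₂ _*_ (gram-sym u i i′) (gram-sym u i i′)) ⟩
  ∑[ i < m ] ∑[ i′ < m ] (gram u i i′ * gram u i i′) ∎

gram-double-counting : ∀ m n (u : Fin m → Fin n → ℕ) → ZeroOne u →
  Σpairs m (λ i i′ → gram u i i′ * gram u i i′) + Σpairs n (gram (flip u))
    ≡ Σpairs n (λ k k′ → gram (flip u) k k′ * gram (flip u) k k′) + Σpairs m (gram u)
gram-double-counting m n u u01 = *-cancelˡ-≡ _ _ 2 (+-cancelʳ-≡ (∑[ i < m ] ∑[ k < n ] u i k) _ _ (begin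
  2 * (A + b) + ∑[ i < m ] ∑[ k < n ] u i k
    ≡⟨ regroup A b _ ⟩
  2 * A + (2 * b + ∑[ i < m ] ∑[ k < n ] u i k)
    ≡⟨ cong (λ s → 2 * A + (2 * b + s)) (∑-comm {m} {n} u) ⟩
  2 * A + (2 * b + ∑[ k < n ] ∑[ i < m ] u i k)
    ≡⟨ cong (2 * A +_) (2*Σpairs-gram n m (flip u) u01ᵀ) ⟩
  2 * A + ∑[ i < m ] (∑[ k < n ] u i k * ∑[ k < n ] u i k)
    ≡⟨ 2*Σpairs-gram-squared m n u u01 ⟩
  ∑[ i < m ] ∑[ i′ < m ] (gram u i i′ * gram u i i′)
    ≡⟨ ∑∑-gram-squared m n u ⟩
  ∑[ k < n ] ∑[ k′ < n ] (gram (flip u) k k′ * gram (flip u) k k′)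
    ≡⟨ sym (2*Σpairs-gram-squared n m (flip u) u01ᵀ) ⟩
  2 * B + ∑[ k < n ] (∑[ i < m ] u i k * ∑[ i < m ] u i k)
    ≡⟨ cong (2 * B +_) (sym (2*Σpairs-gram m n u u01)) ⟩
  2 * B + (2 * a + ∑[ i < m ] ∑[ k < n ] u i k)
    ≡⟨ sym (regroup B a _) ⟩
  2 * (B + a) + ∑[ i < m ] ∑[ k < n ] u i k ∎))
  where
  A a B b : ℕ
  A = Σpairs m (λ i i′ → gram u i i′ * gram u i i′)
  a = Σpairs m (gram u)
  B = Σpairs n (λ k k′ → gram (flip u) k k′ * gram (flip u) k k′)
  b = Σpairs n (gram (flip u))
  u01ᵀ : ZeroOne (flip u)
  u01ᵀ k i = u01 i k
  regroup : ∀ x y z → 2 * (x + y) + z ≡ 2 * x + (2 * y + z)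
  regroup = solve-∀

Σpairs-gram-flip : ∀ m n (u : Fin m → Fin n → ℕ) → ZeroOne u →
  Σpairs n (gram (flip u)) ≡ ∑[ i < m ] ((∑[ k < n ] u i k) C 2)
Σpairs-gram-flip m n u u01 = *-cancelˡ-≡ _ _ 2 (+-cancelʳ-≡ (∑[ k < n ] ∑[ i < m ] u i k) _ _ (begin
  2 * Σpairs n (gram (flip u)) + ∑[ k < n ] ∑[ i < m ] u i k
    ≡⟨ 2*Σpairs-gram n m (flip u) (λ k i → u01 i k) ⟩
  ∑[ i < m ] (row i * row i)
    ≡⟨ sum-cong-≗ {m} (λ i → sym (2*nC2+n≡n*n (row i))) ⟩
  ∑[ i < m ] (2 * (row i C 2) + row i)
    ≡⟨ ∑-distrib-+ {m} _ _ ⟩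
  ∑[ i < m ] (2 * (row i C 2)) + ∑[ i < m ] row i
    ≡⟨ cong₂ _+_ (sym (*-distribˡ-sum {m} 2 _)) (∑-comm {m} {n} u) ⟩
  2 * ∑[ i < m ] (row i C 2) + ∑[ k < n ] ∑[ i < m ] u i k ∎))
  where
  row : Fin m → ℕ
  row i = ∑[ k < n ] u i k

-- Sums of squares about the mean

-- defect a x = (x − a)(x − a − 1), computed without subtraction
defect : ℕ → ℕ → ℕ
defect zero    zero    = 0
defect zero    (suc x) = suc x * x
defect (suc a) zero    = suc a * suc (suc a)
defect (suc a) (suc x) = defect a x

defect-identity : ∀ a x → x * x + a * suc a ≡ suc (2 * a) * x + defect a x
defect-identity zero    zero    = refl
defect-identity zero    (suc x) = identity x
  where
  identity : ∀ x → suc x * suc x + 0 * 1 ≡ suc (2 * 0) * suc x + suc x * x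
  identity = solve-∀
defect-identity (suc a) zero    = identity a
  where
  identity : ∀ a → 0 * 0 + suc a * suc (suc a) ≡ suc (2 * suc a) * 0 + suc a * suc (suc a)
  identity = solve-∀
defect-identity (suc a) (suc x) = begin
  suc x * suc x + suc a * suc (suc a)                 ≡⟨ shift a x ⟩
  (x * x + a * suc a) + (2 * x + 2 * a + 3)           ≡⟨ cong (_+ (2 * x + 2 * a + 3)) (defect-identity a x) ⟩
  (suc (2 * a) * x + defect a x) + (2 * x + 2 * a + 3) ≡⟨ unshift a x (defect a x) ⟩
  suc (2 * suc a) * suc x + defect a x                ∎
  where
  shift : ∀ a x → suc x * suc x + suc a * suc (suc a) ≡ (x * x + a * suc a) + (2 * x + 2 * a + 3)
  shift = solve-∀
  unshift : ∀ a x d → (suc (2 * a) * x + d) + (2 * x + 2 * a + 3) ≡ suc (2 * suc a) * suc x + d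
  unshift = solve-∀

defect-self : ∀ a → defect a a ≡ 0
defect-self zero    = refl
defect-self (suc a) = defect-self a

defect-suc : ∀ a → defect a (suc a) ≡ 0
defect-suc zero    = refl
defect-suc (suc a) = defect-suc a

defect≡0⇒ : ∀ a x → defect a x ≡ 0 → x ≡ a ⊎ x ≡ suc a
defect≡0⇒ zero    zero          _ = inj₁ refl
defect≡0⇒ zero    (suc zero)    _ = inj₂ refl
defect≡0⇒ (suc a) (suc x) d≡0 = Sum.map (cong suc) (cong suc) (defect≡0⇒ a x d≡0)

Σpairs-squares : ∀ n a (f : Fin n → Fin n → ℕ) →
  Σpairs n (λ i j → f i j * f i j) + a * suc a * (n C 2) ≡ suc (2 * a) * Σpairs n f + Σpairs n (λ i j → defect a (f i j))
Σpairs-squares n a f = begin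
  Σpairs n (λ i j → f i j * f i j) + a * suc a * (n C 2)
    ≡⟨ cong (Σpairs n (λ i j → f i j * f i j) +_) (sym (Σpairs-const n (a * suc a))) ⟩
  Σpairs n (λ i j → f i j * f i j) + Σpairs n (λ _ _ → a * suc a)
    ≡⟨ sym (Σpairs-+ n _ _) ⟩
  Σpairs n (λ i j → f i j * f i j + a * suc a)
    ≡⟨ Σpairs-cong n (λ i j _ → defect-identity a (f i j)) ⟩
  Σpairs n (λ i j → suc (2 * a) * f i j + defect a (f i j))
    ≡⟨ Σpairs-+ n _ _ ⟩
  Σpairs n (λ i j → suc (2 * a) * f i j) + Σpairs n (λ i j → defect a (f i j))
    ≡⟨ cong (_+ Σpairs n (λ i j → defect a (f i j))) (sym (Σpairs-*ˡ n (suc (2 * a)) f)) ⟩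
  suc (2 * a) * Σpairs n f + Σpairs n (λ i j → defect a (f i j)) ∎

fromℚᵘ-homo-+ : ∀ p q → ℚ.fromℚᵘ (p ℚᵘ.+ q) ≡ ℚ.fromℚᵘ p ℚ.+ ℚ.fromℚᵘ q
fromℚᵘ-homo-+ p q = ℚₚ.toℚᵘ-injective (ℚᵘₚ.≃-trans (ℚₚ.toℚᵘ-fromℚᵘ _) (ℚᵘₚ.≃-sym
  (ℚᵘₚ.≃-trans (ℚₚ.toℚᵘ-homo-+ (ℚ.fromℚᵘ p) (ℚ.fromℚᵘ q)) (ℚᵘₚ.+-cong (ℚₚ.toℚᵘ-fromℚᵘ p) (ℚₚ.toℚᵘ-fromℚᵘ q)))))

fromℚᵘ-homo-* : ∀ p q → ℚ.fromℚᵘ (p ℚᵘ.* q) ≡ ℚ.fromℚᵘ p ℚ.* ℚ.fromℚᵘ q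
fromℚᵘ-homo-* p q = ℚₚ.toℚᵘ-injective (ℚᵘₚ.≃-trans (ℚₚ.toℚᵘ-fromℚᵘ _) (ℚᵘₚ.≃-sym
  (ℚᵘₚ.≃-trans (ℚₚ.toℚᵘ-homo-* (ℚ.fromℚᵘ p) (ℚ.fromℚᵘ q)) (ℚᵘₚ.*-cong (ℚₚ.toℚᵘ-fromℚᵘ p) (ℚₚ.toℚᵘ-fromℚᵘ q)))))

-- ℕ→ℚ n and frac L (suc n) are definitionally ℚ.fromℚᵘ (ℕ→ℚᵘ n) and ℚ.fromℚᵘ (mkℚᵘ (ℤ.+ L) n),
-- so identities between them can be checked in ℚᵘ.
ℕ→ℚᵘ : ℕ → ℚᵘ
ℕ→ℚᵘ n = mkℚᵘ (ℤ.+ n) 0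

ℕ→ℚ-+ : ∀ m n → ℕ→ℚ (m + n) ≡ ℕ→ℚ m ℚ.+ ℕ→ℚ n
ℕ→ℚ-+ m n =
  trans (ℚₚ.fromℚᵘ-cong {ℕ→ℚᵘ (m + n)} {ℕ→ℚᵘ m ℚᵘ.+ ℕ→ℚᵘ n} (*≡* (cong (ℤ._* ℤ.+ 1) numerators)))
        (fromℚᵘ-homo-+ (ℕ→ℚᵘ m) (ℕ→ℚᵘ n))
  where
  numerators : ℤ.+ (m + n) ≡ ℤ.+ m ℤ.* ℤ.+ 1 ℤ.+ ℤ.+ n ℤ.* ℤ.+ 1
  numerators = trans (ℤₚ.pos-+ m n) (sym (cong₂ ℤ._+_ (ℤₚ.*-identityʳ (ℤ.+ m)) (ℤₚ.*-identityʳ (ℤ.+ n))))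

ℕ→ℚ-* : ∀ m n → ℕ→ℚ (m * n) ≡ ℕ→ℚ m ℚ.* ℕ→ℚ n
ℕ→ℚ-* m n =
  trans (ℚₚ.fromℚᵘ-cong {ℕ→ℚᵘ (m * n)} {ℕ→ℚᵘ m ℚᵘ.* ℕ→ℚᵘ n} (*≡* (cong (ℤ._* ℤ.+ 1) (ℤₚ.pos-* m n))))
        (fromℚᵘ-homo-* (ℕ→ℚᵘ m) (ℕ→ℚᵘ n))

ℕ→ℚ-injective : ∀ {m n} → ℕ→ℚ m ≡ ℕ→ℚ n → m ≡ n
ℕ→ℚ-injective {m} {n} eq with ℚₚ.fromℚᵘ-injective {ℕ→ℚᵘ m} {ℕ→ℚᵘ n} eq
... | *≡* m*1≡n*1 = ℤₚ.+-injective (trans (sym (ℤₚ.*-identityʳ (ℤ.+ m))) (trans m*1≡n*1 (ℤₚ.*-identityʳ (ℤ.+ n))))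

p≤p+h*½ : ∀ p h → p ℚ.≤ p ℚ.+ ℕ→ℚ h ℚ.* ℚ.½
p≤p+h*½ p h =
  subst (ℚ._≤ p ℚ.+ ℕ→ℚ h ℚ.* ℚ.½) (ℚₚ.+-identityʳ p) (ℚₚ.+-monoʳ-≤ p (ℚₚ.nonNegative⁻¹ _ {{h*½-nonNeg}}))
  where
  h*½-nonNeg : ℚ.NonNegative (ℕ→ℚ h ℚ.* ℚ.½)
  h*½-nonNeg = ℚₚ.nonNeg*nonNeg⇒nonNeg (ℕ→ℚ h) {{ℚₚ.normalize-nonNeg h 1}} ℚ.½

p+h*½≡p⇒h≡0 : ∀ p h → p ℚ.+ ℕ→ℚ h ℚ.* ℚ.½ ≡ p → h ≡ 0
p+h*½≡p⇒h≡0 p h p+h*½≡p = ℕ→ℚ-injective (begin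
  ℕ→ℚ h                         ≡⟨ double-half (ℕ→ℚ h) ⟩
  (ℕ→ℚ h ℚ.* ℚ.½) ℚ.* ℕ→ℚ 2     ≡⟨ cong (ℚ._* ℕ→ℚ 2) (identityʳ-unique p _ p+h*½≡p) ⟩
  ℚ.0ℚ ℚ.* ℕ→ℚ 2                ≡⟨ ℚₚ.*-zeroˡ (ℕ→ℚ 2) ⟩
  ℚ.0ℚ                          ∎)
  where
  open +-*-Solver
  double-half : ∀ q → q ≡ (q ℚ.* ℚ.½) ℚ.* ℕ→ℚ 2
  double-half = solve 1 (λ q → q := (q :* con ℚ.½) :* con (ℕ→ℚ 2)) refl

floor-mkℚ+ : ∀ q d .{{_ : NonZero d}} .(q⊥d : Coprime q d) → floor (mkℚ+ q d q⊥d) ≡ ℤ.+ (q / d)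
floor-mkℚ+ q (suc d) _ = ℤₚ.*-identityˡ _

ceiling-mkℚ+-∣ : ∀ q d .{{_ : NonZero d}} .(q⊥d : Coprime q d) → q % d ≡ 0 → ceiling (mkℚ+ q d q⊥d) ≡ ℤ.+ (q / d)
ceiling-mkℚ+-∣ zero    (suc d) _ _ = refl
ceiling-mkℚ+-∣ (suc q) (suc d) _ d∣q rewrite d∣q = trans (cong ℤ.-_ (ℤₚ.*-identityˡ _)) (ℤₚ.neg-involutive _)

ceiling-mkℚ+-∤ : ∀ q d .{{_ : NonZero d}} .(q⊥d : Coprime q d) → q % d ≢ 0 → ceiling (mkℚ+ q d q⊥d) ≡ ℤ.+ suc (q / d)
ceiling-mkℚ+-∤ zero    (suc d) _ d∤q = contradiction refl d∤q
ceiling-mkℚ+-∤ (suc q) (suc d) _ d∤q with suc q % suc d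
... | zero  = contradiction refl d∤q
... | suc _ = cong ℤ.-_ (ℤₚ.*-identityˡ ℤ.-[1+ suc q / suc d ])

frac≡normalize : ∀ L N .{{_ : NonZero N}} → frac L N ≡ ℚ.normalize L N
frac≡normalize L (suc n) = refl

module _ (L N : ℕ) .{{_ : NonZero N}} where

  private
    g : ℕ
    g = gcd L N
    instance
      g≢0 : NonZero g
      g≢0 = ℕ.≢-nonZero (gcd[m,n]≢0 L N (inj₂ (ℕ.≢-nonZero⁻¹ N)))
      N/g≢0 : NonZero (N / g)
      N/g≢0 = ℕ.≢-nonZero (n/gcd[m,n]≢0 L N)
      N/g*g≢0 : NonZero (N / g * g)
      N/g*g≢0 = m*n≢0 (N / g) g

    reduced-quotient : (L / g) / (N / g) ≡ L / N
    reduced-quotient = trans (sym (m*n/o*n≡m/o (L / g) g (N / g)))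
      (trans (/-congˡ {o = N / g * g} (m/n*n≡m (gcd[m,n]∣m L N))) (/-congʳ (m/n*n≡m (gcd[m,n]∣n L N))))

    reduced-remainder : (L / g) % (N / g) * g ≡ L % N
    reduced-remainder = trans (m%n*o≡m*o%[n*o] (L / g) (N / g) g)
      (trans (%-congˡ {o = N / g * g} (m/n*n≡m (gcd[m,n]∣m L N))) (%-congʳ (m/n*n≡m (gcd[m,n]∣n L N))))

  floor-frac : floor (frac L N) ≡ ℤ.+ (L / N)
  floor-frac = begin
    floor (frac L N)          ≡⟨ cong floor (frac≡normalize L N) ⟩
    floor (ℚ.normalize L N)   ≡⟨ floor-mkℚ+ (L / g) (N / g) _ ⟩
    ℤ.+ ((L / g) / (N / g))   ≡⟨ cong ℤ.+_ reduced-quotient ⟩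
    ℤ.+ (L / N)               ∎

  ceiling-frac-∣ : L % N ≡ 0 → ceiling (frac L N) ≡ ℤ.+ (L / N)
  ceiling-frac-∣ N∣L = begin
    ceiling (frac L N)          ≡⟨ cong ceiling (frac≡normalize L N) ⟩
    ceiling (ℚ.normalize L N)   ≡⟨ ceiling-mkℚ+-∣ (L / g) (N / g) _ (m*n≡0⇒m≡0 _ g (trans reduced-remainder N∣L)) ⟩
    ℤ.+ ((L / g) / (N / g))     ≡⟨ cong ℤ.+_ reduced-quotient ⟩
    ℤ.+ (L / N)                 ∎

  ceiling-frac-∤ : L % N ≢ 0 → ceiling (frac L N) ≡ ℤ.+ suc (L / N)
  ceiling-frac-∤ N∤L = begin
    ceiling (frac L N)          ≡⟨ cong ceiling (frac≡normalize L N) ⟩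
    ceiling (ℚ.normalize L N)
      ≡⟨ ceiling-mkℚ+-∤ (L / g) (N / g) _ (λ r≡0 → N∤L (trans (sym reduced-remainder) (cong (_* g) r≡0))) ⟩
    ℤ.+ suc ((L / g) / (N / g)) ≡⟨ cong (λ q → ℤ.+ suc q) reduced-quotient ⟩
    ℤ.+ suc (L / N)             ∎

ℕ→ℚ-*-frac : ∀ L N .{{_ : NonZero N}} → ℕ→ℚ N ℚ.* frac L N ≡ ℕ→ℚ L
ℕ→ℚ-*-frac L N@(suc n) =
  trans (sym (fromℚᵘ-homo-* (ℕ→ℚᵘ N) (mkℚᵘ (ℤ.+ L) n)))
        (ℚₚ.fromℚᵘ-cong {ℕ→ℚᵘ N ℚᵘ.* mkℚᵘ (ℤ.+ L) n} {ℕ→ℚᵘ L} (*≡* cross-multiplied))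
  where
  cross-multiplied : (ℤ.+ N ℤ.* ℤ.+ L) ℤ.* ℤ.+ 1 ≡ ℤ.+ L ℤ.* ℤ.+ (1 * N)
  cross-multiplied = begin
    (ℤ.+ N ℤ.* ℤ.+ L) ℤ.* ℤ.+ 1  ≡⟨ ℤₚ.*-identityʳ _ ⟩
    ℤ.+ N ℤ.* ℤ.+ L              ≡⟨ sym (ℤₚ.pos-* N L) ⟩
    ℤ.+ (N * L)                  ≡⟨ cong ℤ.+_ (commute N L) ⟩
    ℤ.+ (L * (1 * N))            ≡⟨ ℤₚ.pos-* L (1 * N) ⟩
    ℤ.+ L ℤ.* ℤ.+ (1 * N)        ∎
    where
    commute : ∀ N L → N * L ≡ L * (1 * N)
    commute = solve-∀

frac-∣ : ∀ L N .{{_ : NonZero N}} → L % N ≡ 0 → frac L N ≡ ℕ→ℚ (L / N)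
frac-∣ L N@(suc n) N∣L = ℚₚ.fromℚᵘ-cong {mkℚᵘ (ℤ.+ L) n} {ℕ→ℚᵘ (L / N)} (*≡* (begin
  ℤ.+ L ℤ.* ℤ.+ 1        ≡⟨ ℤₚ.*-identityʳ _ ⟩
  ℤ.+ L                  ≡⟨ cong ℤ.+_ (trans (m≡m%n+[m/n]*n L N) (cong (_+ L / N * N) N∣L)) ⟩
  ℤ.+ (L / N * N)        ≡⟨ ℤₚ.pos-* (L / N) N ⟩
  ℤ.+ (L / N) ℤ.* ℤ.+ N  ∎))

2*S-closed-form : ∀ n m (â : ℚ) → ℤ→ℚ (floor m) ≡ â →
  (m ℚ.- â) ℚ.* (ℤ→ℚ (ceiling m) ℚ.- m) ≡ (m ℚ.- â) ℚ.* ((ℚ.1ℚ ℚ.+ â) ℚ.- m) →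
  ℕ→ℚ 2 ℚ.* S n m ℚ.+ (â ℚ.* (ℚ.1ℚ ℚ.+ â)) ℚ.* ℕ→ℚ n ≡ (ℕ→ℚ 2 ℚ.* â) ℚ.* (ℕ→ℚ n ℚ.* m)
2*S-closed-form n m â ⌊m⌋≡â ceiling-term = begin
  ℕ→ℚ 2 ℚ.* S n m ℚ.+ (â ℚ.* (ℚ.1ℚ ℚ.+ â)) ℚ.* n̂
    ≡⟨ cong (λ t → ℕ→ℚ 2 ℚ.* (n̂ ℚ.* binom2 m ℚ.+ t ℚ.* ℚ.½) ℚ.+ (â ℚ.* (ℚ.1ℚ ℚ.+ â)) ℚ.* n̂) last-term ⟩
  ℕ→ℚ 2 ℚ.* (n̂ ℚ.* binom2 m ℚ.+ (n̂ ℚ.* ((m ℚ.- â) ℚ.* ((ℚ.1ℚ ℚ.+ â) ℚ.- m))) ℚ.* ℚ.½) ℚ.+ (â ℚ.* (ℚ.1ℚ ℚ.+ â)) ℚ.* n̂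
    ≡⟨ identity n̂ m â ⟩
  (ℕ→ℚ 2 ℚ.* â) ℚ.* (n̂ ℚ.* m) ∎
  where
  n̂ : ℚ
  n̂ = ℕ→ℚ n
  last-term : (n̂ ℚ.* (m ℚ.- ℤ→ℚ (floor m))) ℚ.* (ℤ→ℚ (ceiling m) ℚ.- m)
                ≡ n̂ ℚ.* ((m ℚ.- â) ℚ.* ((ℚ.1ℚ ℚ.+ â) ℚ.- m))
  last-term = begin
    (n̂ ℚ.* (m ℚ.- ℤ→ℚ (floor m))) ℚ.* (ℤ→ℚ (ceiling m) ℚ.- m)
      ≡⟨ cong (λ fl → (n̂ ℚ.* (m ℚ.- fl)) ℚ.* (ℤ→ℚ (ceiling m) ℚ.- m)) ⌊m⌋≡â ⟩
    (n̂ ℚ.* (m ℚ.- â)) ℚ.* (ℤ→ℚ (ceiling m) ℚ.- m)               ≡⟨ ℚₚ.*-assoc n̂ _ _ ⟩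
    n̂ ℚ.* ((m ℚ.- â) ℚ.* (ℤ→ℚ (ceiling m) ℚ.- m))               ≡⟨ cong (n̂ ℚ.*_) ceiling-term ⟩
    n̂ ℚ.* ((m ℚ.- â) ℚ.* ((ℚ.1ℚ ℚ.+ â) ℚ.- m))                  ∎
  identity : ∀ n̂ m â →
    ℕ→ℚ 2 ℚ.* (n̂ ℚ.* binom2 m ℚ.+ (n̂ ℚ.* ((m ℚ.- â) ℚ.* ((ℚ.1ℚ ℚ.+ â) ℚ.- m))) ℚ.* ℚ.½) ℚ.+ (â ℚ.* (ℚ.1ℚ ℚ.+ â)) ℚ.* n̂
      ≡ (ℕ→ℚ 2 ℚ.* â) ℚ.* (n̂ ℚ.* m)
  identity = solve 3 (λ n̂ m â →
    con (ℕ→ℚ 2) :* (n̂ :* ((m :* (m :- con ℚ.1ℚ)) :* con ℚ.½) :+ (n̂ :* ((m :- â) :* ((con ℚ.1ℚ :+ â) :- m))) :* con ℚ.½)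
      :+ (â :* (con ℚ.1ℚ :+ â)) :* n̂
    := (con (ℕ→ℚ 2) :* â) :* (n̂ :* m)) refl
    where open +-*-Solver

-- Either ⌈L / N⌉ = ⌊L / N⌋ + 1, or L / N is an integer and both sides vanish.
frac-ceiling-term : ∀ L N .{{_ : NonZero N}} →
  (frac L N ℚ.- ℕ→ℚ (L / N)) ℚ.* (ℤ→ℚ (ceiling (frac L N)) ℚ.- frac L N)
    ≡ (frac L N ℚ.- ℕ→ℚ (L / N)) ℚ.* ((ℚ.1ℚ ℚ.+ ℕ→ℚ (L / N)) ℚ.- frac L N)
frac-ceiling-term L N with L % N ℕ.≟ 0
... | no N∤L = cong (λ c → (frac L N ℚ.- â) ℚ.* (c ℚ.- frac L N))
                    (trans (cong ℤ→ℚ (ceiling-frac-∤ L N N∤L)) (ℕ→ℚ-+ 1 (L / N)))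
  where
  â : ℚ
  â = ℕ→ℚ (L / N)
... | yes N∣L = begin
  (frac L N ℚ.- â) ℚ.* (ℤ→ℚ (ceiling (frac L N)) ℚ.- frac L N)
    ≡⟨ cong₂ (λ m c → (m ℚ.- â) ℚ.* (c ℚ.- m)) (frac-∣ L N N∣L) (cong ℤ→ℚ (ceiling-frac-∣ L N N∣L)) ⟩
  (â ℚ.- â) ℚ.* (â ℚ.- â)
    ≡⟨ vanishing â ⟩
  (â ℚ.- â) ℚ.* ((ℚ.1ℚ ℚ.+ â) ℚ.- â)
    ≡⟨ cong (λ m → (m ℚ.- â) ℚ.* ((ℚ.1ℚ ℚ.+ â) ℚ.- m)) (sym (frac-∣ L N N∣L)) ⟩
  (frac L N ℚ.- â) ℚ.* ((ℚ.1ℚ ℚ.+ â) ℚ.- frac L N) ∎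
  where
  â : ℚ
  â = ℕ→ℚ (L / N)
  vanishing : ∀ â → (â ℚ.- â) ℚ.* (â ℚ.- â) ≡ (â ℚ.- â) ℚ.* ((ℚ.1ℚ ℚ.+ â) ℚ.- â)
  vanishing = solve 1 (λ â → (â :- â) :* (â :- â) := (â :- â) :* ((con ℚ.1ℚ :+ â) :- â)) refl
    where open +-*-Solver

S-frac : ∀ L N .{{_ : NonZero N}} →
  ℕ→ℚ 2 ℚ.* S N (frac L N) ℚ.+ ℕ→ℚ (L / N * suc (L / N) * N) ≡ ℕ→ℚ (2 * (L / N) * L)
S-frac L N = begin
  ℕ→ℚ 2 ℚ.* S N m ℚ.+ ℕ→ℚ (a * suc a * N)      ≡⟨ cong (ℕ→ℚ 2 ℚ.* S N m ℚ.+_) product-image ⟩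
  ℕ→ℚ 2 ℚ.* S N m ℚ.+ (â ℚ.* (ℚ.1ℚ ℚ.+ â)) ℚ.* ℕ→ℚ N
    ≡⟨ 2*S-closed-form N m â (cong ℤ→ℚ (floor-frac L N)) (frac-ceiling-term L N) ⟩
  (ℕ→ℚ 2 ℚ.* â) ℚ.* (ℕ→ℚ N ℚ.* m)              ≡⟨ cong ((ℕ→ℚ 2 ℚ.* â) ℚ.*_) (ℕ→ℚ-*-frac L N) ⟩
  (ℕ→ℚ 2 ℚ.* â) ℚ.* ℕ→ℚ L                      ≡⟨ sym (trans (ℕ→ℚ-* (2 * a) L) (cong (ℚ._* ℕ→ℚ L) (ℕ→ℚ-* 2 a))) ⟩
  ℕ→ℚ (2 * a * L)                              ∎
  where
  a : ℕ
  a = L / N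
  m â : ℚ
  m = frac L N
  â = ℕ→ℚ a
  product-image : ℕ→ℚ (a * suc a * N) ≡ (â ℚ.* (ℚ.1ℚ ℚ.+ â)) ℚ.* ℕ→ℚ N
  product-image =
    trans (ℕ→ℚ-* (a * suc a) N) (cong (ℚ._* ℕ→ℚ N) (trans (ℕ→ℚ-* a (suc a)) (cong (â ℚ.*_) (ℕ→ℚ-+ 1 a))))

Σpairs-squares-S : ∀ n L (f : Fin n → Fin n → ℕ) .{{_ : NonZero (n C 2)}} → Σpairs n f ≡ L →
  ℕ→ℚ (Σpairs n (λ i j → f i j * f i j))
    ≡ ℕ→ℚ (L + Σpairs n (λ i j → defect (L / (n C 2)) (f i j))) ℚ.+ ℕ→ℚ 2 ℚ.* S (n C 2) (frac L (n C 2))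
Σpairs-squares-S n L f Σf≡L = ∙-cancelʳ (ℕ→ℚ K) _ _ (begin
  ℕ→ℚ G ℚ.+ ℕ→ℚ K                                    ≡⟨ sym (ℕ→ℚ-+ G K) ⟩
  ℕ→ℚ (G + K)                                        ≡⟨ cong ℕ→ℚ in-ℕ ⟩
  ℕ→ℚ ((L + H) + 2 * a * L)                          ≡⟨ ℕ→ℚ-+ (L + H) (2 * a * L) ⟩
  ℕ→ℚ (L + H) ℚ.+ ℕ→ℚ (2 * a * L)                    ≡⟨ cong (ℕ→ℚ (L + H) ℚ.+_) (sym (S-frac L N)) ⟩
  ℕ→ℚ (L + H) ℚ.+ (ℕ→ℚ 2 ℚ.* S N m ℚ.+ ℕ→ℚ K)        ≡⟨ sym (ℚₚ.+-assoc (ℕ→ℚ (L + H)) _ _) ⟩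
  (ℕ→ℚ (L + H) ℚ.+ ℕ→ℚ 2 ℚ.* S N m) ℚ.+ ℕ→ℚ K        ∎)
  where
  N a G H K : ℕ
  N = n C 2
  a = L / N
  G = Σpairs n (λ i j → f i j * f i j)
  H = Σpairs n (λ i j → defect a (f i j))
  K = a * suc a * N
  m : ℚ
  m = frac L N
  in-ℕ : G + K ≡ (L + H) + 2 * a * L
  in-ℕ = trans (Σpairs-squares n a f) (trans (cong (λ l → suc (2 * a) * l + H) Σf≡L) (regroup a L H))
    where
    regroup : ∀ a L H → suc (2 * a) * L + H ≡ (L + H) + 2 * a * L
    regroup = solve-∀

FloorOrCeil-frac⇒ : ∀ L N .{{_ : NonZero N}} {x} → FloorOrCeil x (frac L N) → x ≡ L / N ⊎ x ≡ suc (L / N)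
FloorOrCeil-frac⇒ L N (inj₁ x≡⌊m⌋) = inj₁ (ℤₚ.+-injective (trans x≡⌊m⌋ (floor-frac L N)))
FloorOrCeil-frac⇒ L N (inj₂ x≡⌈m⌉) with L % N ℕ.≟ 0
... | yes N∣L = inj₁ (ℤₚ.+-injective (trans x≡⌈m⌉ (ceiling-frac-∣ L N N∣L)))
... | no  N∤L = inj₂ (ℤₚ.+-injective (trans x≡⌈m⌉ (ceiling-frac-∤ L N N∤L)))

FloorOrCeil⇒defect≡0 : ∀ L N .{{_ : NonZero N}} {x} → FloorOrCeil x (frac L N) → defect (L / N) x ≡ 0
FloorOrCeil⇒defect≡0 L N x≈m with FloorOrCeil-frac⇒ L N x≈m
... | inj₁ refl = defect-self (L / N)
... | inj₂ refl = defect-suc (L / N)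

-- When N ∣ L the band {a, a + 1} is wider than {⌊m⌋, ⌈m⌉} = {a}, and the sum Σ f = a N excludes a + 1.
Σpairs-defect≡0⇒FloorOrCeil : ∀ n L (f : Fin n → Fin n → ℕ) .{{_ : NonZero (n C 2)}} → Σpairs n f ≡ L →
  Σpairs n (λ i j → defect (L / (n C 2)) (f i j)) ≡ 0 →
  ∀ i j → toℕ i < toℕ j → FloorOrCeil (f i j) (frac L (n C 2))
Σpairs-defect≡0⇒FloorOrCeil n L f Σf≡L H≡0 i j i<j = band⇒FloorOrCeil (in-band i j i<j)
  where
  N a : ℕ
  N = n C 2
  a = L / N
  in-band : ∀ i j → toℕ i < toℕ j → f i j ≡ a ⊎ f i j ≡ suc a
  in-band i j i<j = defect≡0⇒ a (f i j) (Σpairs≡0⇒ n _ H≡0 i j i<j)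
  a≤f : ∀ i j → toℕ i < toℕ j → a ≤ f i j
  a≤f i j i<j with in-band i j i<j
  ... | inj₁ f≡a   = ≤-reflexive (sym f≡a)
  ... | inj₂ f≡1+a = subst (a ≤_) (sym f≡1+a) (n≤1+n a)
  band⇒FloorOrCeil : f i j ≡ a ⊎ f i j ≡ suc a → FloorOrCeil (f i j) (frac L N)
  band⇒FloorOrCeil (inj₁ f≡a) = inj₁ (trans (cong ℤ.+_ f≡a) (sym (floor-frac L N)))
  band⇒FloorOrCeil (inj₂ f≡1+a) with L % N ℕ.≟ 0
  ... | no  N∤L = inj₂ (trans (cong ℤ.+_ f≡1+a) (sym (ceiling-frac-∤ L N N∤L)))
  ... | yes N∣L = contradiction (trans (sym f≡1+a) (Σpairs-tight n a f a≤f Σf≡aN i j i<j)) 1+n≢n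
    where
    Σf≡aN : Σpairs n f ≡ a * N
    Σf≡aN = trans Σf≡L (trans (m≡m%n+[m/n]*n L N) (cong (_+ a * N) N∣L))

S-gap : ∀ (gX lX gP lP h sX sP : ℚ) →
  gX ≡ lX ℚ.+ ℕ→ℚ 2 ℚ.* sX → gP ≡ (lP ℚ.+ h) ℚ.+ ℕ→ℚ 2 ℚ.* sP → gX ℚ.+ lP ≡ gP ℚ.+ lX →
  sX ≡ sP ℚ.+ h ℚ.* ℚ.½
S-gap gX lX gP lP h sX sP gX≡ gP≡ balance = begin
  sX                                                                  ≡⟨ isolate lX lP sX ⟩
  ℚ.½ ℚ.* (((lX ℚ.+ ℕ→ℚ 2 ℚ.* sX) ℚ.+ lP) ℚ.- lX ℚ.- lP)              ≡⟨ cong (λ g → ℚ.½ ℚ.* ((g ℚ.+ lP) ℚ.- lX ℚ.- lP)) (sym gX≡) ⟩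
  ℚ.½ ℚ.* ((gX ℚ.+ lP) ℚ.- lX ℚ.- lP)                                 ≡⟨ cong (λ g → ℚ.½ ℚ.* (g ℚ.- lX ℚ.- lP)) balance ⟩
  ℚ.½ ℚ.* ((gP ℚ.+ lX) ℚ.- lX ℚ.- lP)                                 ≡⟨ cong (λ g → ℚ.½ ℚ.* ((g ℚ.+ lX) ℚ.- lX ℚ.- lP)) gP≡ ⟩
  ℚ.½ ℚ.* ((((lP ℚ.+ h) ℚ.+ ℕ→ℚ 2 ℚ.* sP) ℚ.+ lX) ℚ.- lX ℚ.- lP)     ≡⟨ collect lX lP h sP ⟩
  sP ℚ.+ h ℚ.* ℚ.½                                                    ∎
  where
  open +-*-Solver
  isolate : ∀ lX lP sX → sX ≡ ℚ.½ ℚ.* (((lX ℚ.+ ℕ→ℚ 2 ℚ.* sX) ℚ.+ lP) ℚ.- lX ℚ.- lP)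
  isolate = solve 3 (λ lX lP sX → sX := con ℚ.½ :* (((lX :+ con (ℕ→ℚ 2) :* sX) :+ lP) :- lX :- lP)) refl
  collect : ∀ lX lP h sP →
    ℚ.½ ℚ.* ((((lP ℚ.+ h) ℚ.+ ℕ→ℚ 2 ℚ.* sP) ℚ.+ lX) ℚ.- lX ℚ.- lP) ≡ sP ℚ.+ h ℚ.* ℚ.½
  collect = solve 4 (λ lX lP h sP →
    con ℚ.½ :* ((((lP :+ h) :+ con (ℕ→ℚ 2) :* sP) :+ lX) :- lX :- lP) := sP :+ h :* con ℚ.½) refl

-- Near triple arrays

does≡true⇒ : ∀ {A : Set} (a? : Dec A) → does a? ≡ true → A
does≡true⇒ (yes a) _ = a

indicator : Bool → ℕ
indicator b = if b then 1 else 0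

indicator-∧ : ∀ a b → indicator (a ∧ b) ≡ indicator a * indicator b
indicator-∧ true  b = sym (+-identityʳ (indicator b))
indicator-∧ false b = refl

anyF-suc : ∀ n (p : Fin (suc n) → Bool) → anyF (suc n) p ≡ (if p zero then true else anyF n (p ∘ suc))
anyF-suc n p = cong (if p zero then true else_)
  (trans (cong (foldr step false) (sym (map-tabulate id suc))) (foldr-map step suc false (allFin n)))
  where
  step : Fin (suc n) → Bool → Bool
  step i b = if p i then true else b

anyF-count : ∀ n (p : Fin n → Bool) → (∀ i i′ → p i ≡ true → p i′ ≡ true → i ≡ i′) →
  indicator (anyF n p) ≡ ∑[ i < n ] indicator (p i)
anyF-count zero    p unique = refl
anyF-count (suc n) p unique rewrite anyF-suc n p with p zero in p0≡
... | true  = cong suc (sym (trans (sum-cong-≗ {n} rest-false) (sum-replicate-zero n)))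
  where
  rest-false : ∀ i → indicator (p (suc i)) ≡ 0
  rest-false i with p (suc i) in pi≡
  ... | true  = contradiction (unique zero (suc i) p0≡ pi≡) λ ()
  ... | false = refl
... | false = anyF-count n (p ∘ suc) (λ i i′ pi≡ pi′≡ → suc-injective (unique (suc i) (suc i′) pi≡ pi′≡))

nC2-nonZero : ∀ {n} → 2 ≤ n → NonZero (n C 2)
nC2-nonZero {suc zero} (s≤s ())
nC2-nonZero {suc (suc k)} _ rewrite sym (nCk+nC[k+1]≡[n+1]C[k+1] (suc k) 1) | nC1≡n (suc k) = _

module _ {r c v : ℕ} (T : Design r c v) where

  incidence : Fin c → Fin v → ℕ
  incidence j s = indicator (inCol T j s)

  incidence-ZeroOne : ZeroOne incidence
  incidence-ZeroOne j s with inCol T j s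
  ... | true  = refl
  ... | false = refl

  colColInt≡gram : ∀ j j′ → colColInt T j j′ ≡ gram incidence j j′
  colColInt≡gram j j′ = trans (Σ≡∑ v _) (sum-cong-≗ {v} (λ s → indicator-∧ (inCol T j s) (inCol T j′ s)))

  pairColCount≡gram : ∀ s t → pairColCount T s t ≡ gram (flip incidence) s t
  pairColCount≡gram s t = trans (Σ≡∑ c _) (sum-cong-≗ {c} (λ j → indicator-∧ (inCol T j s) (inCol T j t)))

  column-size : Binary T → ∀ j → ∑[ s < v ] incidence j s ≡ r
  column-size (_ , column-injective) j = begin
    ∑[ s < v ] indicator (anyF r (λ i → does (T i j ≟ s)))
      ≡⟨ sum-cong-≗ {v} (λ s → anyF-count r _ (λ i i′ Tij≡s Ti′j≡s →
           column-injective i i′ j (trans (witness Tij≡s) (sym (witness Ti′j≡s))))) ⟩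
    ∑[ s < v ] ∑[ i < r ] indicator (does (T i j ≟ s))
      ≡⟨ ∑-comm {v} {r} _ ⟩
    ∑[ i < r ] ∑[ s < v ] indicator (does (T i j ≟ s))
      ≡⟨ sum-cong-≗ {r} (λ i → ∑-δ (T i j) (λ _ → 1)) ⟩
    ∑[ i < r ] 1
      ≡⟨ trans (∑-const r 1) (*-identityʳ r) ⟩
    r ∎
    where
    witness : ∀ {x y : Fin v} → does (x ≟ y) ≡ true → x ≡ y
    witness {x} {y} = does≡true⇒ (x ≟ y)

  Σpairs-pairColCount : Binary T → Σpairs v (pairColCount T) ≡ (r C 2) * c
  Σpairs-pairColCount binary = begin
    Σpairs v (pairColCount T)                    ≡⟨ Σpairs-cong v (λ s t _ → pairColCount≡gram s t) ⟩
    Σpairs v (gram (flip incidence))             ≡⟨ Σpairs-gram-flip c v incidence incidence-ZeroOne ⟩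
    ∑[ j < c ] ((∑[ s < v ] incidence j s) C 2)  ≡⟨ sum-cong-≗ {c} (λ j → cong (_C 2) (column-size binary j)) ⟩
    ∑[ j < c ] (r C 2)                           ≡⟨ trans (∑-const c (r C 2)) (*-comm c (r C 2)) ⟩
    (r C 2) * c                                  ∎

  double-counting :
    Σpairs c (λ j j′ → colColInt T j j′ * colColInt T j j′) + Σpairs v (pairColCount T)
      ≡ Σpairs v (λ s t → pairColCount T s t * pairColCount T s t) + Σpairs c (colColInt T)
  double-counting =
    trans (cong₂ _+_ (Σpairs-cong c (λ j j′ _ → squared (colColInt≡gram j j′)))
                     (Σpairs-cong v (λ s t _ → pairColCount≡gram s t)))
      (trans (gram-double-counting c v incidence incidence-ZeroOne)
        (sym (cong₂ _+_ (Σpairs-cong v (λ s t _ → squared (pairColCount≡gram s t)))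
                        (Σpairs-cong c (λ j j′ _ → colColInt≡gram j j′)))))
    where
    squared : ∀ {x y} → x ≡ y → x * x ≡ y * y
    squared x≡y = cong₂ _*_ x≡y x≡y

  pairColCount-sym : ∀ s t → pairColCount T s t ≡ pairColCount T t s
  pairColCount-sym s t = trans (pairColCount≡gram s t) (trans (gram-sym (flip incidence) s t) (sym (pairColCount≡gram t s)))

  module _ .{{_ : NonZero (c C 2)}} .{{_ : NonZero (v C 2)}} where

    pairDefect : ℕ
    pairDefect = Σpairs v (λ s t → defect ((r C 2) * c / (v C 2)) (pairColCount T s t))

    S-gap-near-triple-array : Binary T → (∀ j j′ → j ≢ j′ → FloorOrCeil (colColInt T j j′) (λcc T)) →
      S (c C 2) (λcc T) ≡ S (v C 2) (μc r c v) ℚ.+ ℕ→ℚ pairDefect ℚ.* ℚ.½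
    S-gap-near-triple-array binary colColInt-band =
      S-gap (ℕ→ℚ Gc) (ℕ→ℚ Lc) (ℕ→ℚ Gv) (ℕ→ℚ Lv) (ℕ→ℚ pairDefect) (S (c C 2) (λcc T)) (S (v C 2) (μc r c v))
        columns pairs balance
      where
      Gc Lc Gv Lv : ℕ
      Gc = Σpairs c (λ j j′ → colColInt T j j′ * colColInt T j j′)
      Lc = Σpairs c (colColInt T)
      Gv = Σpairs v (λ s t → pairColCount T s t * pairColCount T s t)
      Lv = (r C 2) * c
      columnDefect≡0 : Σpairs c (λ j j′ → defect (Lc / (c C 2)) (colColInt T j j′)) ≡ 0
      columnDefect≡0 =
        Σpairs-zero c _ (λ j j′ j<j′ → FloorOrCeil⇒defect≡0 Lc (c C 2) (colColInt-band j j′ (<⇒≢ j<j′)))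
      columns : ℕ→ℚ Gc ≡ ℕ→ℚ Lc ℚ.+ ℕ→ℚ 2 ℚ.* S (c C 2) (λcc T)
      columns = trans (Σpairs-squares-S c Lc (colColInt T) refl)
        (cong (λ h → ℕ→ℚ h ℚ.+ ℕ→ℚ 2 ℚ.* S (c C 2) (λcc T)) (trans (cong (Lc +_) columnDefect≡0) (+-identityʳ Lc)))
      pairs : ℕ→ℚ Gv ≡ (ℕ→ℚ Lv ℚ.+ ℕ→ℚ pairDefect) ℚ.+ ℕ→ℚ 2 ℚ.* S (v C 2) (μc r c v)
      pairs = trans (Σpairs-squares-S v Lv (pairColCount T) (Σpairs-pairColCount binary))
        (cong (ℚ._+ ℕ→ℚ 2 ℚ.* S (v C 2) (μc r c v)) (ℕ→ℚ-+ Lv pairDefect))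
      balance : ℕ→ℚ Gc ℚ.+ ℕ→ℚ Lv ≡ ℕ→ℚ Gv ℚ.+ ℕ→ℚ Lc
      balance = begin
        ℕ→ℚ Gc ℚ.+ ℕ→ℚ Lv  ≡⟨ sym (ℕ→ℚ-+ Gc Lv) ⟩
        ℕ→ℚ (Gc + Lv)      ≡⟨ cong (λ l → ℕ→ℚ (Gc + l)) (sym (Σpairs-pairColCount binary)) ⟩
        ℕ→ℚ (Gc + Σpairs v (pairColCount T)) ≡⟨ cong ℕ→ℚ double-counting ⟩
        ℕ→ℚ (Gv + Lc)      ≡⟨ ℕ→ℚ-+ Gv Lc ⟩
        ℕ→ℚ Gv ℚ.+ ℕ→ℚ Lc  ∎

    pairDefect≡0⇒band : Binary T → pairDefect ≡ 0 → ∀ s t → s ≢ t → FloorOrCeil (pairColCount T s t) (μc r c v)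
    pairDefect≡0⇒band binary pairDefect≡0 =
      off-diagonal-by-symmetry {P = λ x → FloorOrCeil x (μc r c v)} (pairColCount T) pairColCount-sym
        (Σpairs-defect≡0⇒FloorOrCeil v ((r C 2) * c) (pairColCount T) (Σpairs-pairColCount binary) pairDefect≡0)

    band⇒pairDefect≡0 : (∀ s t → s ≢ t → FloorOrCeil (pairColCount T s t) (μc r c v)) → pairDefect ≡ 0
    band⇒pairDefect≡0 band =
      Σpairs-zero v _ (λ s t s<t → FloorOrCeil⇒defect≡0 ((r C 2) * c) (v C 2) (band s t (<⇒≢ s<t)))

theorem6p2 : (r c v : ℕ) → 2 ≤ r → 2 ≤ c → 2 ≤ v → (T : Design r c v) → IsNearTripleArray T
    → (S (c C 2) (λcc T) ≥ S (v C 2) (μc r c v))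
    × ((S (c C 2) (λcc T) ≡ S (v C 2) (μc r c v))
    ⇔ (∀ s t → s ≢ t → FloorOrCeil (pairColCount T s t) (μc r c v)))
theorem6p2 r c v _ 2≤c 2≤v T (binary , _ , _ , _ , colColInt-band) =
  subst (Sv ℚ.≤_) (sym gap) (p≤p+h*½ Sv (pairDefect T)) ,
  mk⇔ (λ Sc≡Sv → pairDefect≡0⇒band T binary (p+h*½≡p⇒h≡0 Sv (pairDefect T) (trans (sym gap) Sc≡Sv)))
      (λ band → trans gap (trans (cong (λ h → Sv ℚ.+ ℕ→ℚ h ℚ.* ℚ.½) (band⇒pairDefect≡0 T band))
                                 (ℚₚ.+-identityʳ Sv)))
  where
  instance
    c₂≢0 : NonZero (c C 2)
    c₂≢0 = nC2-nonZero 2≤c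
    v₂≢0 : NonZero (v C 2)
    v₂≢0 = nC2-nonZero 2≤v
  Sv : ℚ
  Sv = S (v C 2) (μc r c v)
  gap : S (c C 2) (λcc T) ≡ Sv ℚ.+ ℕ→ℚ (pairDefect T) ℚ.* ℚ.½
  gap = S-gap-near-triple-array T binary colColInt-band
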